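{- Let $G_1$ and $G_2$ be graphs with disjoint vertex sets. Then $\mathrm{indthin}(G_1\vee G_2)=\mathrm{indthin}(G_1)+\mathrm{indthin}(G_2)$ and $\mathrm{indpthin}(G_1\vee G_2)=\mathrm{indpthin}(G_1)+\mathrm{indpthin}(G_2)$.
   Context: Graphs are finite, simple, undirected. The join $G_1\vee G_2$ has vertex set $V_1\cup V_2$ and edge set $E_1\cup E_2\cup\{vv': v\in V_1, v'\in V_2\}$. For a graph $G=(V,E)$, an ordering $v_1,\dots,v_n$ of $V$ and a partition of $V$ are consistent if for every $r<s<t$, whenever $v_r,v_s$ are in the same class and $v_tv_r\in E$, then $v_tv_s\in E$; they are strongly consistent if moreover for every $r<s<t$, whenever $v_s,v_t$ are in the same class and $v_tv_r\in E$, then $v_sv_r\in E$. $\mathrm{indthin}(G)$ is the minimum $k$ such that some ordering of $V$ and some partition of $V$ into $k$ independent sets are consistent; $\mathrm{indpthin}(G)$ is defined likewise with strongly consistent. -}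

module Defs where

open import Data.Nat using (ℕ; _+_; _≤_; _<_)
open import Data.Fin using (Fin; toℕ; splitAt)
open import Data.Sum using (_⊎_; inj₁; inj₂)
open import Data.Product using (Σ; ∃; _×_; _,_)
open import Data.Empty using (⊥)
open import Data.Unit using (⊤)
open import Relation.Binary.PropositionalEquality using (_≡_)
open import Relation.Nullary using (¬_)
open import Function.Bundles using (_↔_)

record Graph : Set₁ where
  field
    n     : ℕ
    Adj   : Fin n → Fin n → Set
    sym   : ∀ {u v} → Adj u v → Adj v u
    irrefl : ∀ {u} → ¬ Adj u u
open Graph public

-- Join of two graphs; the vertex set Fin (n₁ + n₂) is the disjoint union
-- of the two vertex sets (via splitAt).
joinAdj : (G₁ G₂ : Graph) → Fin (n G₁ + n G₂) → Fin (n G₁ + n G₂) → Set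
joinAdj G₁ G₂ u v with splitAt (n G₁) u | splitAt (n G₁) v
... | inj₁ a | inj₁ b = Adj G₁ a b
... | inj₂ a | inj₂ b = Adj G₂ a b
... | inj₁ _ | inj₂ _ = ⊤
... | inj₂ _ | inj₁ _ = ⊤

joinSym : (G₁ G₂ : Graph) → ∀ {u v} → joinAdj G₁ G₂ u v → joinAdj G₁ G₂ v u
joinSym G₁ G₂ {u} {v} p with splitAt (n G₁) u | splitAt (n G₁) v
... | inj₁ a | inj₁ b = sym G₁ p
... | inj₂ a | inj₂ b = sym G₂ p
... | inj₁ _ | inj₂ _ = _
... | inj₂ _ | inj₁ _ = _

joinIrrefl : (G₁ G₂ : Graph) → ∀ {u} → ¬ joinAdj G₁ G₂ u u
joinIrrefl G₁ G₂ {u} p with splitAt (n G₁) u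
... | inj₁ a = irrefl G₁ p
... | inj₂ a = irrefl G₂ p

_∨G_ : Graph → Graph → Graph
G₁ ∨G G₂ = record
  { n = n G₁ + n G₂
  ; Adj = joinAdj G₁ G₂
  ; sym = joinSym G₁ G₂
  ; irrefl = joinIrrefl G₁ G₂
  }

-- An ordering v_1,…,v_n of V is a bijection pos : V ↔ Fin n (pos v = index
-- of v in the ordering).  A partition of V into k classes is a map
-- cls : V → Fin k that is surjective (every class nonempty).
Ordering : Graph → Set
Ordering G = Fin (n G) ↔ Fin (n G)

module _ (G : Graph) where
  open Function.Bundles.Inverse

  Before : Ordering G → Fin (n G) → Fin (n G) → Set
  Before σ u v = toℕ (to σ u) < toℕ (to σ v)

  IndependentPartition : (k : ℕ) → (Fin (n G) → Fin k) → Set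
  IndependentPartition k cls =
    (∀ c → ∃ λ v → cls v ≡ c) ×
    (∀ u v → cls u ≡ cls v → ¬ Adj G u v)

  Consistent : Ordering G → {k : ℕ} → (Fin (n G) → Fin k) → Set
  Consistent σ cls = ∀ r s t → Before σ r s → Before σ s t →
    cls r ≡ cls s → Adj G t r → Adj G t s

  StronglyConsistent : Ordering G → {k : ℕ} → (Fin (n G) → Fin k) → Set
  StronglyConsistent σ cls = Consistent σ cls ×
    (∀ r s t → Before σ r s → Before σ s t →
      cls s ≡ cls t → Adj G t r → Adj G s r)

  IndThinWith : ℕ → Set
  IndThinWith k = Σ (Ordering G) λ σ → Σ (Fin (n G) → Fin k) λ cls →
    IndependentPartition k cls × Consistent σ cls

  IndPThinWith : ℕ → Set
  IndPThinWith k = Σ (Ordering G) λ σ → Σ (Fin (n G) → Fin k) λ cls →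
    IndependentPartition k cls × StronglyConsistent σ cls

  IsIndThin : ℕ → Set
  IsIndThin k = IndThinWith k × (∀ k′ → IndThinWith k′ → k ≤ k′)

  IsIndPThin : ℕ → Set
  IsIndPThin k = IndPThinWith k × (∀ k′ → IndPThinWith k′ → k ≤ k′)

module Submission where

-- Upper bound: list the vertices of G₁ (in an optimal order for G₁) before
-- those of G₂ and rename the classes of G₂ to k₁, …, k₁ + k₂ - 1.  Two vertices
-- of one class then lie on the same side, and every vertex of the other side
-- is adjacent to both, so (strong) consistency for the join reduces to
-- (strong) consistency on each side.
--
-- Lower bound: independence and (strong) consistency pass to induced
-- subgraphs, once the induced ordering is re-ranked onto Fin (n H) and the
-- classes met by H are renumbered onto an initial segment.  Restricting a
-- pair with k classes for G₁ ∨ G₂ to each side gives pairs with k₁′ and k₂′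
-- classes, and no class meets both sides since all cross edges are present;
-- hence k₁ + k₂ ≤ k₁′ + k₂′ ≤ k.
--
-- Both renumberings are one construction, developed first: every map
-- h : Fin m → Fin k is the increasing enumeration of its image (a subset of
-- Fin k, encoded as a bit vector) after a surjection `compress h`.

open import Data.Bool using (Bool; true; false)
open import Data.Empty using (⊥; ⊥-elim)
open import Data.Fin using (Fin; zero; suc; toℕ; cast; _≟_; _↑ˡ_; _↑ʳ_; splitAt; join)
open import Data.Fin.Properties
  using (toℕ-injective; toℕ-cast; cast-involutive; any?; injective⇒≤; +↔⊎;
         splitAt-↑ˡ; splitAt-↑ʳ; join-splitAt; toℕ-↑ˡ; toℕ-↑ʳ; ↑ˡ-injective; ↑ʳ-injective; toℕ<n)
open import Data.Nat using (ℕ; suc; _+_; _≤_; _<_; z≤n; s≤s)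
open import Data.Nat.Properties
  using (≤-antisym; ≤-trans; n≤1+n; +-suc; <-cmp; <-irrefl; +-mono-≤; +-cancelˡ-<; m≤m+n)
open import Data.Product using (∃; _×_; _,_; proj₁; proj₂)
open import Data.Sum using (_⊎_; inj₁; inj₂; map)
open import Data.Sum.Function.Propositional using (_⊎-↔_)
open import Data.Unit using (tt)
open import Data.Vec using (Vec; []; _∷_; lookup; tabulate)
open import Data.Vec.Properties using (lookup∘tabulate)
open import Function using (_∘_; id)
open import Function.Bundles using (_↔_; Inverse; Injection; mk↔ₛ′)
open import Function.Properties.Inverse using (↔-sym; ↔-trans; ↔⇒↣)
open import Relation.Binary using (tri<; tri≈; tri>)
open import Relation.Binary.PropositionalEquality
open import Relation.Nullary using (does; yes; ¬_)
open import Relation.Nullary.Decidable using (dec-true)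

open import Defs hiding (sym)

open Inverse using (to)

size : ∀ {k} → Vec Bool k → ℕ
size []          = 0
size (true ∷ S)  = suc (size S)
size (false ∷ S) = size S

enum : ∀ {k} (S : Vec Bool k) → Fin (size S) → Fin k
enum (true ∷ S)  zero    = zero
enum (true ∷ S)  (suc i) = suc (enum S i)
enum (false ∷ S) i       = suc (enum S i)

enum-∈ : ∀ {k} (S : Vec Bool k) i → lookup S (enum S i) ≡ true
enum-∈ (true ∷ S)  zero    = refl
enum-∈ (true ∷ S)  (suc i) = enum-∈ S i
enum-∈ (false ∷ S) i       = enum-∈ S i

enum-mono : ∀ {k} (S : Vec Bool k) {i j} → toℕ i < toℕ j → toℕ (enum S i) < toℕ (enum S j)
enum-mono (true ∷ S)  {zero}  {suc j} _         = s≤s z≤n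
enum-mono (true ∷ S)  {suc i} {suc j} (s≤s i<j) = s≤s (enum-mono S i<j)
enum-mono (false ∷ S)                 i<j       = s≤s (enum-mono S i<j)

enum-injective : ∀ {k} (S : Vec Bool k) {i j} → enum S i ≡ enum S j → i ≡ j
enum-injective S {i} {j} eq with <-cmp (toℕ i) (toℕ j)
... | tri< i<j _ _ = ⊥-elim (<-irrefl (cong toℕ eq) (enum-mono S i<j))
... | tri≈ _ i≡j _ = toℕ-injective i≡j
... | tri> _ _ j<i = ⊥-elim (<-irrefl (cong toℕ (sym eq)) (enum-mono S j<i))

rank : ∀ {k} (S : Vec Bool k) (c : Fin k) → lookup S c ≡ true → Fin (size S)
rank (true ∷ S)  zero    _   = zero
rank (true ∷ S)  (suc c) c∈S = suc (rank S c c∈S)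
rank (false ∷ S) (suc c) c∈S = rank S c c∈S

enum-rank : ∀ {k} (S : Vec Bool k) c (c∈S : lookup S c ≡ true) → enum S (rank S c c∈S) ≡ c
enum-rank (true ∷ S)  zero    _   = refl
enum-rank (true ∷ S)  (suc c) c∈S = cong suc (enum-rank S c c∈S)
enum-rank (false ∷ S) (suc c) c∈S = cong suc (enum-rank S c c∈S)

size-disjoint : ∀ {k} (S T : Vec Bool k) →
  (∀ c → lookup S c ≡ true → lookup T c ≡ true → ⊥) → size S + size T ≤ k
size-disjoint []          []          _        = z≤n
size-disjoint (true ∷ S)  (true ∷ T)  disjoint = ⊥-elim (disjoint zero refl refl)
size-disjoint (true ∷ S)  (false ∷ T) disjoint = s≤s (size-disjoint S T (disjoint ∘ suc))
size-disjoint (false ∷ S) (true ∷ T)  disjoint rewrite +-suc (size S) (size T) =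
  s≤s (size-disjoint S T (disjoint ∘ suc))
size-disjoint (false ∷ S) (false ∷ T) disjoint =
  ≤-trans (size-disjoint S T (disjoint ∘ suc)) (n≤1+n _)

module _ {m k : ℕ} (h : Fin m → Fin k) where

  image : Vec Bool k
  image = tabulate λ c → does (any? λ a → h a ≟ c)

  image-∋ : ∀ a → lookup image (h a) ≡ true
  image-∋ a = trans (lookup∘tabulate _ (h a)) (dec-true (any? λ b → h b ≟ h a) (a , refl))

  image-witness : ∀ c → lookup image c ≡ true → ∃ λ a → h a ≡ c
  image-witness c c∈image
    with any? (λ a → h a ≟ c) | trans (sym (lookup∘tabulate _ c)) c∈image
  ... | yes found | _ = found

  compress : Fin m → Fin (size image)
  compress a = rank image (h a) (image-∋ a)

  enum-compress : ∀ a → enum image (compress a) ≡ h a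
  enum-compress a = enum-rank image (h a) (image-∋ a)

  compress-surjective : ∀ i → ∃ λ a → compress a ≡ i
  compress-surjective i with image-witness (enum image i) (enum-∈ image i)
  ... | a , ha≡ = a , enum-injective image (trans (enum-compress a) ha≡)

  compress-reflects-≡ : ∀ {a b} → compress a ≡ compress b → h a ≡ h b
  compress-reflects-≡ {a} {b} eq = begin
    h a                     ≡⟨ enum-compress a ⟨
    enum image (compress a) ≡⟨ cong (enum image) eq ⟩
    enum image (compress b) ≡⟨ enum-compress b ⟩
    h b                     ∎
    where open ≡-Reasoning

  compress-reflects-< : ∀ {a b} → toℕ (compress a) < toℕ (compress b) → toℕ (h a) < toℕ (h b)
  compress-reflects-< {a} {b} lt =
    subst₂ (λ x y → toℕ x < toℕ y) (enum-compress a) (enum-compress b) (enum-mono image lt)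

  module _ (h-injective : ∀ {a b} → h a ≡ h b → a ≡ b) where

    compress-↔ : Fin m ↔ Fin (size image)
    compress-↔ = mk↔ₛ′ compress (proj₁ ∘ compress-surjective)
      (proj₂ ∘ compress-surjective)
      (λ a → h-injective (compress-reflects-≡ (proj₂ (compress-surjective (compress a)))))

    size-image : size image ≡ m
    size-image = ≤-antisym (injective⇒≤ (Injection.injective (↔⇒↣ (↔-sym compress-↔))))
                           (injective⇒≤ (Injection.injective (↔⇒↣ compress-↔)))

cast-↔ : ∀ {m n} → m ≡ n → Fin m ↔ Fin n
cast-↔ eq = mk↔ₛ′ (cast eq) (cast (sym eq)) (cast-involutive eq (sym eq)) (cast-involutive (sym eq) eq)

ranking : ∀ {m k} (h : Fin m → Fin k) → (∀ {a b} → h a ≡ h b → a ≡ b) → Fin m ↔ Fin m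
ranking h h-injective = ↔-trans (compress-↔ h h-injective) (cast-↔ (size-image h h-injective))

ranking-< : ∀ {m k} (h : Fin m → Fin k) (h-injective : ∀ {a b} → h a ≡ h b → a ≡ b) {a b} →
  toℕ (to (ranking h h-injective) a) < toℕ (to (ranking h h-injective) b) → toℕ (h a) < toℕ (h b)
ranking-< h h-injective {a} {b} =
  compress-reflects-< h ∘ subst₂ _<_ (toℕ-cast _ (compress h a)) (toℕ-cast _ (compress h b))

record InducedEmbedding (H G : Graph) : Set where
  field
    vertex           : Fin (n H) → Fin (n G)
    vertex-injective : ∀ {a b} → vertex a ≡ vertex b → a ≡ b
    adj-preserve     : ∀ {a b} → Adj H a b → Adj G (vertex a) (vertex b)
    adj-reflect      : ∀ {a b} → Adj G (vertex a) (vertex b) → Adj H a b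

classesMet : ∀ {H G k} → InducedEmbedding H G → (Fin (n G) → Fin k) → ℕ
classesMet e cls = size (image (cls ∘ InducedEmbedding.vertex e))

module Restriction {H G : Graph} (e : InducedEmbedding H G)
  {k : ℕ} (σ : Ordering G) (cls : Fin (n G) → Fin k) where
  open InducedEmbedding e

  position-injective : ∀ {a b} → to σ (vertex a) ≡ to σ (vertex b) → a ≡ b
  position-injective = vertex-injective ∘ Injection.injective (↔⇒↣ σ)

  τ : Ordering H
  τ = ranking (to σ ∘ vertex) position-injective

  τ-before : ∀ {a b} → Before H τ a b → Before G σ (vertex a) (vertex b)
  τ-before = ranking-< (to σ ∘ vertex) position-injective

  cls′ : Fin (n H) → Fin (classesMet e cls)
  cls′ = compress (cls ∘ vertex)

  same-class : ∀ {a b} → cls′ a ≡ cls′ b → cls (vertex a) ≡ cls (vertex b)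
  same-class = compress-reflects-≡ (cls ∘ vertex)

  independent : IndependentPartition G k cls → IndependentPartition H (classesMet e cls) cls′
  independent (_ , indep) =
    compress-surjective (cls ∘ vertex) ,
    λ a b a~b adj → indep (vertex a) (vertex b) (same-class a~b) (adj-preserve adj)

  consistent : Consistent G σ cls → Consistent H τ cls′
  consistent cons r s t r<s s<t r~s tr = adj-reflect
    (cons (vertex r) (vertex s) (vertex t) (τ-before r<s) (τ-before s<t) (same-class r~s) (adj-preserve tr))

  stronglyConsistent : StronglyConsistent G σ cls → StronglyConsistent H τ cls′
  stronglyConsistent (cons , cons′) = consistent cons ,
    λ r s t r<s s<t s~t tr → adj-reflect
      (cons′ (vertex r) (vertex s) (vertex t) (τ-before r<s) (τ-before s<t) (same-class s~t) (adj-preserve tr))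

restrict-thin : ∀ {H G k} (e : InducedEmbedding H G) (σ : Ordering G) (cls : Fin (n G) → Fin k) →
  IndependentPartition G k cls → Consistent G σ cls → IndThinWith H (classesMet e cls)
restrict-thin e σ cls indep cons = τ , cls′ , independent indep , consistent cons
  where open Restriction e σ cls

restrict-pthin : ∀ {H G k} (e : InducedEmbedding H G) (σ : Ordering G) (cls : Fin (n G) → Fin k) →
  IndependentPartition G k cls → StronglyConsistent G σ cls → IndPThinWith H (classesMet e cls)
restrict-pthin e σ cls indep cons = τ , cls′ , independent indep , stronglyConsistent cons
  where open Restriction e σ cls

data Side (m n : ℕ) : Fin (m + n) → Set where
  left  : (a : Fin m) → Side m n (a ↑ˡ n)
  right : (b : Fin n) → Side m n (m ↑ʳ b)

side : ∀ m n (x : Fin (m + n)) → Side m n x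
side m n x = subst (Side m n) (join-splitAt m n x) (side′ (splitAt m x))
  where
  side′ : (y : Fin m ⊎ Fin n) → Side m n (join m n y)
  side′ (inj₁ a) = left a
  side′ (inj₂ b) = right b

left≢right : ∀ {m n} (a : Fin m) (b : Fin n) → a ↑ˡ n ≢ m ↑ʳ b
left≢right {m} {n} a b eq = <-irrefl refl (≤-trans a<m (m≤m+n m (toℕ b)))
  where
  a<m : m + toℕ b < m
  a<m = subst (_< m) (trans (sym (toℕ-↑ˡ a n)) (trans (cong toℕ eq) (toℕ-↑ʳ m b))) (toℕ<n a)

_⊕_ : ∀ {m₁ m₂ k₁ k₂} → (Fin m₁ → Fin k₁) → (Fin m₂ → Fin k₂) → Fin (m₁ + m₂) → Fin (k₁ + k₂)
_⊕_ {m₁} {k₁ = k₁} {k₂} f₁ f₂ x = join k₁ k₂ (map f₁ f₂ (splitAt m₁ x))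

⊕-left : ∀ {m₁ m₂ k₁ k₂} (f₁ : Fin m₁ → Fin k₁) (f₂ : Fin m₂ → Fin k₂) a →
  (f₁ ⊕ f₂) (a ↑ˡ m₂) ≡ f₁ a ↑ˡ k₂
⊕-left {m₁} {m₂} f₁ f₂ a rewrite splitAt-↑ˡ m₁ a m₂ = refl

⊕-right : ∀ {m₁ m₂ k₁ k₂} (f₁ : Fin m₁ → Fin k₁) (f₂ : Fin m₂ → Fin k₂) b →
  (f₁ ⊕ f₂) (m₁ ↑ʳ b) ≡ k₁ ↑ʳ f₂ b
⊕-right {m₁} {m₂} f₁ f₂ b rewrite splitAt-↑ʳ m₁ m₂ b = refl

⊕-left-≡ : ∀ {m₁ m₂ k₁ k₂} (f₁ : Fin m₁ → Fin k₁) (f₂ : Fin m₂ → Fin k₂) {a b} →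
  (f₁ ⊕ f₂) (a ↑ˡ m₂) ≡ (f₁ ⊕ f₂) (b ↑ˡ m₂) → f₁ a ≡ f₁ b
⊕-left-≡ {k₂ = k₂} f₁ f₂ {a} {b} eq =
  ↑ˡ-injective k₂ _ _ (trans (sym (⊕-left f₁ f₂ a)) (trans eq (⊕-left f₁ f₂ b)))

⊕-right-≡ : ∀ {m₁ m₂ k₁ k₂} (f₁ : Fin m₁ → Fin k₁) (f₂ : Fin m₂ → Fin k₂) {a b} →
  (f₁ ⊕ f₂) (m₁ ↑ʳ a) ≡ (f₁ ⊕ f₂) (m₁ ↑ʳ b) → f₂ a ≡ f₂ b
⊕-right-≡ {k₁ = k₁} f₁ f₂ {a} {b} eq =
  ↑ʳ-injective k₁ _ _ (trans (sym (⊕-right f₁ f₂ a)) (trans eq (⊕-right f₁ f₂ b)))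

⊕-cross-≢ : ∀ {m₁ m₂ k₁ k₂} (f₁ : Fin m₁ → Fin k₁) (f₂ : Fin m₂ → Fin k₂) a b →
  (f₁ ⊕ f₂) (a ↑ˡ m₂) ≢ (f₁ ⊕ f₂) (m₁ ↑ʳ b)
⊕-cross-≢ f₁ f₂ a b eq =
  left≢right (f₁ a) (f₂ b) (trans (sym (⊕-left f₁ f₂ a)) (trans eq (⊕-right f₁ f₂ b)))

⊕-left-< : ∀ {m₁ m₂ k₁ k₂} (f₁ : Fin m₁ → Fin k₁) (f₂ : Fin m₂ → Fin k₂) {a b} →
  toℕ ((f₁ ⊕ f₂) (a ↑ˡ m₂)) < toℕ ((f₁ ⊕ f₂) (b ↑ˡ m₂)) → toℕ (f₁ a) < toℕ (f₁ b)
⊕-left-< {k₂ = k₂} f₁ f₂ {a} {b} = subst₂ _<_ (toℕ-left a) (toℕ-left b)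
  where
  toℕ-left : ∀ x → toℕ ((f₁ ⊕ f₂) (x ↑ˡ _)) ≡ toℕ (f₁ x)
  toℕ-left x = trans (cong toℕ (⊕-left f₁ f₂ x)) (toℕ-↑ˡ (f₁ x) k₂)

⊕-right-< : ∀ {m₁ m₂ k₁ k₂} (f₁ : Fin m₁ → Fin k₁) (f₂ : Fin m₂ → Fin k₂) {a b} →
  toℕ ((f₁ ⊕ f₂) (m₁ ↑ʳ a)) < toℕ ((f₁ ⊕ f₂) (m₁ ↑ʳ b)) → toℕ (f₂ a) < toℕ (f₂ b)
⊕-right-< {k₁ = k₁} f₁ f₂ {a} {b} = +-cancelˡ-< k₁ _ _ ∘ subst₂ _<_ (toℕ-right a) (toℕ-right b)
  where
  toℕ-right : ∀ y → toℕ ((f₁ ⊕ f₂) (_ ↑ʳ y)) ≡ k₁ + toℕ (f₂ y)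
  toℕ-right y = trans (cong toℕ (⊕-right f₁ f₂ y)) (toℕ-↑ʳ k₁ (f₂ y))

module Join (G₁ G₂ : Graph) where
  private
    n₁ n₂ : ℕ
    n₁ = n G₁
    n₂ = n G₂

  G₁₂ : Graph
  G₁₂ = G₁ ∨G G₂

  adj-left : ∀ a b → Adj G₁₂ (a ↑ˡ n₂) (b ↑ˡ n₂) ≡ Adj G₁ a b
  adj-left a b rewrite splitAt-↑ˡ n₁ a n₂ | splitAt-↑ˡ n₁ b n₂ = refl

  adj-right : ∀ a b → Adj G₁₂ (n₁ ↑ʳ a) (n₁ ↑ʳ b) ≡ Adj G₂ a b
  adj-right a b rewrite splitAt-↑ʳ n₁ n₂ a | splitAt-↑ʳ n₁ n₂ b = refl

  cross : ∀ a b → Adj G₁₂ (a ↑ˡ n₂) (n₁ ↑ʳ b)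
  cross a b rewrite splitAt-↑ˡ n₁ a n₂ | splitAt-↑ʳ n₁ n₂ b = tt

  cross′ : ∀ a b → Adj G₁₂ (n₁ ↑ʳ b) (a ↑ˡ n₂)
  cross′ a b = Graph.sym G₁₂ (cross a b)

  embed₁ : InducedEmbedding G₁ G₁₂
  embed₁ = record
    { vertex           = _↑ˡ n₂
    ; vertex-injective = ↑ˡ-injective n₂ _ _
    ; adj-preserve     = λ {a} {b} → subst id (sym (adj-left a b))
    ; adj-reflect      = λ {a} {b} → subst id (adj-left a b)
    }

  embed₂ : InducedEmbedding G₂ G₁₂
  embed₂ = record
    { vertex           = n₁ ↑ʳ_
    ; vertex-injective = ↑ʳ-injective n₁ _ _
    ; adj-preserve     = λ {a} {b} → subst id (sym (adj-right a b))
    ; adj-reflect      = λ {a} {b} → subst id (adj-right a b)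
    }

  -- No class of an independent partition of the join meets both sides.
  classes-split : ∀ {k} (cls : Fin (n G₁₂) → Fin k) → IndependentPartition G₁₂ k cls →
    classesMet embed₁ cls + classesMet embed₂ cls ≤ k
  classes-split cls (_ , indep) =
    size-disjoint (image (cls ∘ (_↑ˡ n₂))) (image (cls ∘ (n₁ ↑ʳ_))) disjoint
    where
    disjoint : ∀ c → lookup (image (cls ∘ (_↑ˡ n₂))) c ≡ true →
      lookup (image (cls ∘ (n₁ ↑ʳ_))) c ≡ true → ⊥
    disjoint c c∈₁ c∈₂ with image-witness _ c c∈₁ | image-witness _ c c∈₂
    ... | a , a↦c | b , b↦c = indep (a ↑ˡ n₂) (n₁ ↑ʳ b) (trans a↦c (sym b↦c)) (cross a b)

  thin-lower : ∀ {k₁ k₂} → (∀ k → IndThinWith G₁ k → k₁ ≤ k) → (∀ k → IndThinWith G₂ k → k₂ ≤ k) →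
    ∀ k → IndThinWith G₁₂ k → k₁ + k₂ ≤ k
  thin-lower min₁ min₂ k (σ , cls , indep , cons) = ≤-trans
    (+-mono-≤ (min₁ _ (restrict-thin embed₁ σ cls indep cons)) (min₂ _ (restrict-thin embed₂ σ cls indep cons)))
    (classes-split cls indep)

  pthin-lower : ∀ {k₁ k₂} → (∀ k → IndPThinWith G₁ k → k₁ ≤ k) → (∀ k → IndPThinWith G₂ k → k₂ ≤ k) →
    ∀ k → IndPThinWith G₁₂ k → k₁ + k₂ ≤ k
  pthin-lower min₁ min₂ k (σ , cls , indep , cons) = ≤-trans
    (+-mono-≤ (min₁ _ (restrict-pthin embed₁ σ cls indep cons)) (min₂ _ (restrict-pthin embed₂ σ cls indep cons)))
    (classes-split cls indep)

  module Juxtaposition {k₁ k₂ : ℕ} (σ₁ : Ordering G₁) (σ₂ : Ordering G₂)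
    (c₁ : Fin n₁ → Fin k₁) (c₂ : Fin n₂ → Fin k₂) where
    open InducedEmbedding embed₁ using () renaming (adj-preserve to lift₁; adj-reflect to lower₁)
    open InducedEmbedding embed₂ using () renaming (adj-preserve to lift₂; adj-reflect to lower₂)

    -- Its position map is to σ₁ ⊕ to σ₂ (definitionally).
    ρ : Ordering G₁₂
    ρ = ↔-trans +↔⊎ (↔-trans (σ₁ ⊎-↔ σ₂) (↔-sym +↔⊎))

    cls : Fin (n G₁₂) → Fin (k₁ + k₂)
    cls = c₁ ⊕ c₂

    before₁ : ∀ {a b} → Before G₁₂ ρ (a ↑ˡ n₂) (b ↑ˡ n₂) → Before G₁ σ₁ a b
    before₁ = ⊕-left-< (to σ₁) (to σ₂)

    before₂ : ∀ {a b} → Before G₁₂ ρ (n₁ ↑ʳ a) (n₁ ↑ʳ b) → Before G₂ σ₂ a b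
    before₂ = ⊕-right-< (to σ₁) (to σ₂)

    independent : IndependentPartition G₁ k₁ c₁ → IndependentPartition G₂ k₂ c₂ →
      IndependentPartition G₁₂ (k₁ + k₂) cls
    independent (onto₁ , indep₁) (onto₂ , indep₂) = onto , indep
      where
      onto : ∀ c → ∃ λ v → cls v ≡ c
      onto c with side k₁ k₂ c
      ... | left i  with (a , a↦i) ← onto₁ i = a ↑ˡ n₂ , trans (⊕-left c₁ c₂ a) (cong (_↑ˡ k₂) a↦i)
      ... | right i with (b , b↦i) ← onto₂ i = n₁ ↑ʳ b , trans (⊕-right c₁ c₂ b) (cong (k₁ ↑ʳ_) b↦i)
      indep : ∀ u v → cls u ≡ cls v → ¬ Adj G₁₂ u v
      indep u v u~v with side n₁ n₂ u | side n₁ n₂ v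
      ... | left a  | left b  = indep₁ a b (⊕-left-≡ c₁ c₂ u~v) ∘ lower₁
      ... | right a | right b = indep₂ a b (⊕-right-≡ c₁ c₂ u~v) ∘ lower₂
      ... | left a  | right b = ⊥-elim (⊕-cross-≢ c₁ c₂ a b u~v)
      ... | right b | left a  = ⊥-elim (⊕-cross-≢ c₁ c₂ a b (sym u~v))

    -- Two vertices of one class lie on one side; a later vertex t on that
    -- side is handled there, and one on the other side is adjacent to both.
    consistent : Consistent G₁ σ₁ c₁ → Consistent G₂ σ₂ c₂ → Consistent G₁₂ ρ cls
    consistent cons₁ cons₂ r s t r<s s<t r~s tr with side n₁ n₂ r | side n₁ n₂ s | side n₁ n₂ t
    ... | left a  | left b  | left c  =
      lift₁ (cons₁ a b c (before₁ r<s) (before₁ s<t) (⊕-left-≡ c₁ c₂ r~s) (lower₁ tr))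
    ... | right a | right b | right c =
      lift₂ (cons₂ a b c (before₂ r<s) (before₂ s<t) (⊕-right-≡ c₁ c₂ r~s) (lower₂ tr))
    ... | left a  | left b  | right c = cross′ b c
    ... | right a | right b | left c  = cross c b
    ... | left a  | right b | _       = ⊥-elim (⊕-cross-≢ c₁ c₂ a b r~s)
    ... | right b | left a  | _       = ⊥-elim (⊕-cross-≢ c₁ c₂ a b (sym r~s))

    -- The second condition likewise: s and t share a side, and an earlier r
    -- on the other side is adjacent to s.
    stronglyConsistent : StronglyConsistent G₁ σ₁ c₁ → StronglyConsistent G₂ σ₂ c₂ →
      StronglyConsistent G₁₂ ρ cls
    stronglyConsistent (cons₁ , cons₁′) (cons₂ , cons₂′) = consistent cons₁ cons₂ , cons′
      where
      cons′ : ∀ r s t → Before G₁₂ ρ r s → Before G₁₂ ρ s t → cls s ≡ cls t →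
        Adj G₁₂ t r → Adj G₁₂ s r
      cons′ r s t r<s s<t s~t tr with side n₁ n₂ r | side n₁ n₂ s | side n₁ n₂ t
      ... | left a  | left b  | left c  =
        lift₁ (cons₁′ a b c (before₁ r<s) (before₁ s<t) (⊕-left-≡ c₁ c₂ s~t) (lower₁ tr))
      ... | right a | right b | right c =
        lift₂ (cons₂′ a b c (before₂ r<s) (before₂ s<t) (⊕-right-≡ c₁ c₂ s~t) (lower₂ tr))
      ... | right a | left b  | left c  = cross b a
      ... | left a  | right b | right c = cross′ a b
      ... | _       | left b  | right c = ⊥-elim (⊕-cross-≢ c₁ c₂ b c s~t)
      ... | _       | right c | left b  = ⊥-elim (⊕-cross-≢ c₁ c₂ b c (sym s~t))

  join-thin : ∀ {k₁ k₂} → IndThinWith G₁ k₁ → IndThinWith G₂ k₂ → IndThinWith G₁₂ (k₁ + k₂)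
  join-thin (σ₁ , c₁ , indep₁ , cons₁) (σ₂ , c₂ , indep₂ , cons₂) =
    ρ , cls , independent indep₁ indep₂ , consistent cons₁ cons₂
    where open Juxtaposition σ₁ σ₂ c₁ c₂

  join-pthin : ∀ {k₁ k₂} → IndPThinWith G₁ k₁ → IndPThinWith G₂ k₂ → IndPThinWith G₁₂ (k₁ + k₂)
  join-pthin (σ₁ , c₁ , indep₁ , cons₁) (σ₂ , c₂ , indep₂ , cons₂) =
    ρ , cls , independent indep₁ indep₂ , stronglyConsistent cons₁ cons₂
    where open Juxtaposition σ₁ σ₂ c₁ c₂

theorem4p11 : (G₁ G₂ : Graph) →
    (∀ k₁ k₂ → IsIndThin G₁ k₁ → IsIndThin G₂ k₂ → IsIndThin (G₁ ∨G G₂) (k₁ + k₂)) ×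
    (∀ k₁ k₂ → IsIndPThin G₁ k₁ → IsIndPThin G₂ k₂ → IsIndPThin (G₁ ∨G G₂) (k₁ + k₂))
theorem4p11 G₁ G₂ = thin , pthin
  where
  open Join G₁ G₂
  thin : ∀ k₁ k₂ → IsIndThin G₁ k₁ → IsIndThin G₂ k₂ → IsIndThin G₁₂ (k₁ + k₂)
  thin k₁ k₂ (w₁ , min₁) (w₂ , min₂) = join-thin w₁ w₂ , thin-lower min₁ min₂
  pthin : ∀ k₁ k₂ → IsIndPThin G₁ k₁ → IsIndPThin G₂ k₂ → IsIndPThin G₁₂ (k₁ + k₂)
  pthin k₁ k₂ (w₁ , min₁) (w₂ , min₂) = join-pthin w₁ w₂ , pthin-lower min₁ min₂
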